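{- Let $n\ge 5$ and let $\mathcal{H}$ be a Berge-$K_4$-saturated $3$-graph on $n$ vertices. Then: (i) If $u,v\in V(\mathcal{H})$ and $(u,v)$ is good, then every Berge-$K_4$ in $\mathcal{H}+uv$ which uses the new edge $\{u,v\}$ contains all hyperedges of $\mathcal{H}$ containing both $u$ and $v$. Moreover, $d_{\mathcal{H}}(u,v)\le 2$ and $d_{\mathcal{H}}(w)\ge 3$ for every $w\in N_{\mathcal{H}}(u,v)$. (ii) Let $v_1v_2v_3\in E(\mathcal{H})$ with $d_{\mathcal{H}}(v_1)\le d_{\mathcal{H}}(v_2)\le d_{\mathcal{H}}(v_3)$. If $d_{\mathcal{H}}(v_1)\le 2$, then $(v_2,v_3)$ is bad. If $d_{\mathcal{H}}(v_1)\le d_{\mathcal{H}}(v_2)\le 2$, then $(v_1,v_2)$, $(v_1,v_3)$ and $(v_2,v_3)$ are bad. If $d_{\mathcal{H}}(v_1)\le d_{\mathcal{H}}(v_2)\le d_{\mathcal{H}}(v_3)\le 2$, then $(v_1,u)$, $(v_2,u)$ and $(v_3,u)$ are bad for every $u\in V(\mathcal{H})\setminus\{v_1,v_2,v_3\}$.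
   Context: A $3$-graph is a hypergraph all of whose hyperedges have exactly $3$ vertices. Given a graph $F$, a hypergraph is a Berge-$F$ if there is a bijection $\phi:E(F)\to E(\mathcal{H})$ with $\{u,v\}\subseteq\phi(uv)$ for every $uv\in E(F)$; the vertices of $F$ are the core. A hypergraph contains a Berge-$F$ if some subset of its hyperedges forms a Berge-$F$. A $3$-graph $\mathcal{H}$ is Berge-$K_4$-saturated if it contains no Berge-$K_4$ but adding any $3$-set of vertices that is not a hyperedge creates a Berge-$K_4$. For distinct vertices $u,v$, $\mathcal{H}+uv$ denotes the hypergraph obtained by adding the $2$-element set $\{u,v\}$ as an edge; the pair $(u,v)$ is good if $\mathcal{H}+uv$ contains a new Berge-$K_4$ (one using the edge $\{u,v\}$), equivalently there exist distinct vertices $w,x\notin\{u,v\}$ and five distinct hyperedges of $\mathcal{H}$ containing respectively $\{u,w\},\{u,x\},\{v,w\},\{v,x\},\{w,x\}$; otherwise $(u,v)$ is bad. $d_{\mathcal{H}}(v)$ is the number of hyperedges containing $v$; $N_{\mathcal{H}}(u,v)=\{w: uvw\in E(\mathcal{H})\}$ and $d_{\mathcal{H}}(u,v)=|N_{\mathcal{H}}(u,v)|$. -}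

module Defs where

open import Data.Nat using (ℕ; _≤_)
open import Data.Bool using (Bool)
open import Data.Bool.Properties using () renaming (_≟_ to _≟B_)
open import Data.Fin using (Fin; zero; suc)
open import Data.Fin.Subset using (Subset; ⁅_⁆; _∪_; ∣_∣) renaming (_∈_ to _∈ₛ_)
open import Data.Fin.Subset.Properties using () renaming (_∈?_ to _∈ₛ?_)
open import Data.Vec.Properties using (≡-dec)
open import Data.List using (List; _∷_; length; filter; allFin)
open import Data.List.Relation.Unary.All using (All)
open import Data.List.Relation.Unary.Unique.Propositional using (Unique)
open import Data.List.Membership.Propositional using (_∈_)
open import Data.Product using (_×_; _,_; proj₁; proj₂; Σ; ∃)
open import Function.Definitions using (Injective)
open import Relation.Binary.PropositionalEquality using (_≡_)
open import Relation.Nullary using (¬_; Dec)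
import Data.List.Membership.DecPropositional as DecMem

_≟S_ : ∀ {n} (s t : Subset n) → Dec (s ≡ t)
_≟S_ = ≡-dec _≟B_

record Hyp3 (n : ℕ) : Set where
  field
    edges   : List (Subset n)
    size3   : All (λ e → ∣ e ∣ ≡ 3) edges
    nodup   : Unique edges
open Hyp3 public

pair : ∀ {n} → Fin n → Fin n → Subset n
pair u v = ⁅ u ⁆ ∪ ⁅ v ⁆

triple : ∀ {n} → Fin n → Fin n → Fin n → Subset n
triple u v w = ⁅ u ⁆ ∪ ⁅ v ⁆ ∪ ⁅ w ⁆

k4edge : Fin 6 → Fin 4 × Fin 4
k4edge zero = zero , suc zero
k4edge (suc zero) = zero , suc (suc zero)
k4edge (suc (suc zero)) = zero , suc (suc (suc zero))
k4edge (suc (suc (suc zero))) = suc zero , suc (suc zero)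
k4edge (suc (suc (suc (suc zero)))) = suc zero , suc (suc (suc zero))
k4edge (suc (suc (suc (suc (suc zero))))) = suc (suc zero) , suc (suc (suc zero))

record BergeK4 {n : ℕ} (L : List (Subset n)) : Set where
  field
    core      : Fin 4 → Fin n
    core-inj  : Injective _≡_ _≡_ core
    hedge     : Fin 6 → Subset n
    hedge-inj : Injective _≡_ _≡_ hedge
    hedge-∈   : ∀ k → hedge k ∈ L
    covers₁   : ∀ k → core (proj₁ (k4edge k)) ∈ₛ hedge k
    covers₂   : ∀ k → core (proj₂ (k4edge k)) ∈ₛ hedge k
open BergeK4 public

Saturated : ∀ {n} → Hyp3 n → Set
Saturated {n} H =
  ¬ BergeK4 (edges H) ×
  (∀ (S : Subset n) → ∣ S ∣ ≡ 3 → ¬ (S ∈ edges H) → BergeK4 (S ∷ edges H))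

plusPair : ∀ {n} → Hyp3 n → Fin n → Fin n → List (Subset n)
plusPair H u v = pair u v ∷ edges H

UsesNew : ∀ {n} (H : Hyp3 n) (u v : Fin n) → BergeK4 (plusPair H u v) → Set
UsesNew H u v B = ∃ λ k → hedge B k ≡ pair u v

Good : ∀ {n} → Hyp3 n → Fin n → Fin n → Set
Good H u v = Σ (BergeK4 (plusPair H u v)) (UsesNew H u v)

Bad : ∀ {n} → Hyp3 n → Fin n → Fin n → Set
Bad H u v = ¬ Good H u v

IsEdge : ∀ {n} → Hyp3 n → Subset n → Set
IsEdge H e = e ∈ edges H

deg : ∀ {n} → Hyp3 n → Fin n → ℕ
deg H v = length (filter (v ∈ₛ?_) (edges H))

codegNbrs : ∀ {n} → Hyp3 n → Fin n → Fin n → List (Fin n)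
codegNbrs {n} H u v = filter (λ w → DecMem._∈?_ _≟S_ (triple u v w) (edges H)) (allFin n)

codeg : ∀ {n} → Hyp3 n → Fin n → Fin n → ℕ
codeg H u v = length (codegNbrs H u v)

{-# OPTIONS --safe #-}
-- Let B be a Berge-K4 in H + uv whose hyperedge for the core edge k₀ is {u,v}; the ends of k₀
-- are then u and v, and all other hyperedges of B lie in H. As H is Berge-K4-free, every
-- hyperedge of H through u and v is already a hyperedge of B, since otherwise it could replace
-- {u,v}. Each hyperedge of B other than {u,v} contains one of the two core vertices off k₀, and
-- these lie in three hyperedges of B from H; so the third vertex of an edge uvw has degree ≥ 3
-- and has only two possible values. An end of k₀ lies in two hyperedges of B from H, so any
-- further hyperedge of H through it gives it degree ≥ 3. Each badness claim of (ii) follows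
-- because a good pair would force degree ≥ 3 on a vertex of degree ≤ 2.
module Submission where

open import Defs
open import Data.Nat using (ℕ; _≤_; _+_; z≤n; s≤s)
open import Data.Nat.Properties using (≤-trans; +-monoʳ-≤; n≤1+n; +-suc; 1+n≰n; <⇒≱)
open import Data.Fin using (Fin; _≟_)
open import Data.Fin.Properties using (any?; all?)
open import Data.Fin.Subset using (Subset; ⁅_⁆; _∪_; ∣_∣) renaming (_∈_ to _∈ₛ_)
open import Data.Fin.Subset.Properties using (x∈⁅x⁆; x∈⁅y⁆⇒x≡y; ∣⁅x⁆∣≡1; x∈p∪q⁻; x∈p∪q⁺; ∪-comm; ∪-assoc)
  renaming (_∈?_ to _∈ₛ?_)
open import Data.Bool using (true; false)
open import Data.Vec using ([]; _∷_)
open import Data.List using (List; []; _∷_; length; filter; allFin)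
open import Data.List.Properties using (filter-notAll)
open import Data.List.Relation.Unary.All as All using (All; []; _∷_)
open import Data.List.Relation.Unary.Any as Any using (Any; here; there)
open import Data.List.Relation.Unary.AllPairs using ([]; _∷_)
open import Data.List.Relation.Unary.Unique.Propositional using (Unique)
open import Data.List.Relation.Unary.Unique.Propositional.Properties using (filter⁺; allFin⁺)
open import Data.List.Relation.Binary.Subset.Propositional using (_⊆_)
open import Data.List.Membership.Propositional using (_∈_)
open import Data.List.Membership.Propositional.Properties using (∈-filter⁺; ∈-filter⁻)
import Data.List.Membership.DecPropositional as DecMem
open import Data.Product using (_×_; _,_; proj₁; proj₂; ∃; ∃₂)
open import Data.Sum using (_⊎_; inj₁; inj₂; [_,_]′)
open import Data.Empty using (⊥-elim)
open import Function using (_∘_)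
open import Relation.Nullary using (¬_; Dec; yes; no; ¬?)
open import Relation.Nullary.Decidable using (from-yes; decidable-stable; _⊎-dec_; _×-dec_; _→-dec_)
open import Relation.Unary using (Decidable)
open import Relation.Binary.Definitions using (DecidableEquality)
open import Relation.Binary.PropositionalEquality using (_≡_; _≢_; refl; sym; trans; cong; subst; subst₂)

_∈ᴷ_ : Fin 4 → Fin 6 → Set
j ∈ᴷ k = j ≡ proj₁ (k4edge k) ⊎ j ≡ proj₂ (k4edge k)

_∉ᴷ_ : Fin 4 → Fin 6 → Set
j ∉ᴷ k = ¬ (j ∈ᴷ k)

_∈ᴷ?_ : ∀ j k → Dec (j ∈ᴷ k)
j ∈ᴷ? k = (j ≟ proj₁ (k4edge k)) ⊎-dec (j ≟ proj₂ (k4edge k))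

-- Opaque, so that matching on these exhaustive-search proofs does not unfold them.
abstract
  k4edge-ends-distinct : ∀ k → proj₁ (k4edge k) ≢ proj₂ (k4edge k)
  k4edge-ends-distinct = from-yes (all? λ k → ¬? (proj₁ (k4edge k) ≟ proj₂ (k4edge k)))

  three-edges-at : ∀ j → ∃₂ λ k₁ k₂ → ∃ λ k₃ →
    j ∈ᴷ k₁ × j ∈ᴷ k₂ × j ∈ᴷ k₃ × k₁ ≢ k₂ × k₁ ≢ k₃ × k₂ ≢ k₃
  three-edges-at = from-yes (all? λ j → any? λ k₁ → any? λ k₂ → any? λ k₃ →
    j ∈ᴷ? k₁ ×-dec j ∈ᴷ? k₂ ×-dec j ∈ᴷ? k₃ ×-dec
    ¬? (k₁ ≟ k₂) ×-dec ¬? (k₁ ≟ k₃) ×-dec ¬? (k₂ ≟ k₃))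

  two-other-edges-at-end : ∀ k₀ a → a ∈ᴷ k₀ → ∃₂ λ k₁ k₂ →
    a ∈ᴷ k₁ × a ∈ᴷ k₂ × k₁ ≢ k₂ × k₁ ≢ k₀ × k₂ ≢ k₀
  two-other-edges-at-end = from-yes (all? λ k₀ → all? λ a → a ∈ᴷ? k₀ →-dec
    any? λ k₁ → any? λ k₂ → a ∈ᴷ? k₁ ×-dec a ∈ᴷ? k₂ ×-dec
    ¬? (k₁ ≟ k₂) ×-dec ¬? (k₁ ≟ k₀) ×-dec ¬? (k₂ ≟ k₀))

  end-off-edge : ∀ k₀ k → k ≢ k₀ → ∃ λ j → j ∈ᴷ k × j ∉ᴷ k₀
  end-off-edge = from-yes (all? λ k₀ → all? λ k → ¬? (k ≟ k₀) →-dec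
    any? λ j → j ∈ᴷ? k ×-dec ¬? (j ∈ᴷ? k₀))

  two-vertices-off-edge : ∀ k₀ → ∃₂ λ c d → ∀ j → j ∉ᴷ k₀ → j ≡ c ⊎ j ≡ d
  two-vertices-off-edge = from-yes (all? λ k₀ → any? λ c → any? λ d → all? λ j →
    ¬? (j ∈ᴷ? k₀) →-dec ((j ≟ c) ⊎-dec (j ≟ d)))

  other-edge-misses-an-end : ∀ a b k₀ k → a ≢ b → a ∈ᴷ k₀ → b ∈ᴷ k₀ → k ≢ k₀ →
    a ∉ᴷ k ⊎ b ∉ᴷ k
  other-edge-misses-an-end = from-yes (all? λ a → all? λ b → all? λ k₀ → all? λ k →
    ¬? (a ≟ b) →-dec a ∈ᴷ? k₀ →-dec b ∈ᴷ? k₀ →-dec ¬? (k ≟ k₀) →-dec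
    (¬? (a ∈ᴷ? k) ⊎-dec ¬? (b ∈ᴷ? k)))

module _ {A : Set} (_≟ᴬ_ : DecidableEquality A) where

  Unique-⊆⇒length≤ : ∀ {xs ys : List A} → Unique xs → xs ⊆ ys → length xs ≤ length ys
  Unique-⊆⇒length≤ {[]}     _               _     = z≤n
  Unique-⊆⇒length≤ {x ∷ xs} {ys} (x∉xs ∷ xs!) x∷xs⊆ys =
    ≤-trans (s≤s (Unique-⊆⇒length≤ xs! xs⊆ys-x)) (filter-notAll (¬? ∘ (_≟ᴬ x)) ys x∈ys)
    where
    xs⊆ys-x : xs ⊆ filter (¬? ∘ (_≟ᴬ x)) ys
    xs⊆ys-x z∈xs = ∈-filter⁺ (¬? ∘ (_≟ᴬ x)) (x∷xs⊆ys (there z∈xs)) (All.lookup x∉xs z∈xs ∘ sym)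
    x∈ys : Any (λ z → ¬ z ≢ x) ys
    x∈ys = Any.map (λ { refl z≢z → z≢z refl }) (x∷xs⊆ys (here refl))

∣p∪q∣≤∣p∣+∣q∣ : ∀ {n} (p q : Subset n) → ∣ p ∪ q ∣ ≤ ∣ p ∣ + ∣ q ∣
∣p∪q∣≤∣p∣+∣q∣ []          []          = z≤n
∣p∪q∣≤∣p∣+∣q∣ (true ∷ p)  (true ∷ q)  = s≤s (≤-trans (∣p∪q∣≤∣p∣+∣q∣ p q) (+-monoʳ-≤ ∣ p ∣ (n≤1+n ∣ q ∣)))
∣p∪q∣≤∣p∣+∣q∣ (true ∷ p)  (false ∷ q) = s≤s (∣p∪q∣≤∣p∣+∣q∣ p q)
∣p∪q∣≤∣p∣+∣q∣ (false ∷ p) (true ∷ q)  rewrite +-suc ∣ p ∣ ∣ q ∣ = s≤s (∣p∪q∣≤∣p∣+∣q∣ p q)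
∣p∪q∣≤∣p∣+∣q∣ (false ∷ p) (false ∷ q) = ∣p∪q∣≤∣p∣+∣q∣ p q

module _ {n : ℕ} where

  ∣pair∣≤2 : (x y : Fin n) → ∣ pair x y ∣ ≤ 2
  ∣pair∣≤2 x y = subst₂ (λ a b → ∣ pair x y ∣ ≤ a + b) (∣⁅x⁆∣≡1 x) (∣⁅x⁆∣≡1 y) (∣p∪q∣≤∣p∣+∣q∣ ⁅ x ⁆ ⁅ y ⁆)

  ∈pair⁻ : ∀ {x y z : Fin n} → z ∈ₛ pair x y → z ≡ x ⊎ z ≡ y
  ∈pair⁻ {x} {y} z∈ with x∈p∪q⁻ ⁅ x ⁆ ⁅ y ⁆ z∈
  ... | inj₁ z∈x = inj₁ (x∈⁅y⁆⇒x≡y x z∈x)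
  ... | inj₂ z∈y = inj₂ (x∈⁅y⁆⇒x≡y y z∈y)

  ∈triple⁻ : ∀ {x y w z : Fin n} → z ∈ₛ triple x y w → z ≡ x ⊎ z ≡ y ⊎ z ≡ w
  ∈triple⁻ {x} {y} {w} z∈ with x∈p∪q⁻ ⁅ x ⁆ (pair y w) z∈
  ... | inj₁ z∈x  = inj₁ (x∈⁅y⁆⇒x≡y x z∈x)
  ... | inj₂ z∈yw = inj₂ (∈pair⁻ z∈yw)

  x∈triple : (x y w : Fin n) → x ∈ₛ triple x y w
  x∈triple x y w = x∈p∪q⁺ (inj₁ (x∈⁅x⁆ x))

  y∈triple : (x y w : Fin n) → y ∈ₛ triple x y w
  y∈triple x y w = x∈p∪q⁺ (inj₂ (x∈p∪q⁺ (inj₁ (x∈⁅x⁆ y))))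

  w∈triple : (x y w : Fin n) → w ∈ₛ triple x y w
  w∈triple x y w = x∈p∪q⁺ (inj₂ (x∈p∪q⁺ (inj₂ (x∈⁅x⁆ w))))

  triple-rotate : (x y w : Fin n) → triple x y w ≡ triple y w x
  triple-rotate x y w = trans (∪-comm ⁅ x ⁆ (pair y w)) (∪-assoc ⁅ y ⁆ ⁅ w ⁆ ⁅ x ⁆)

  triple-swap : (x y w : Fin n) → triple x y w ≡ triple x w y
  triple-swap x y w = cong (⁅ x ⁆ ∪_) (∪-comm ⁅ y ⁆ ⁅ w ⁆)

module _ {n : ℕ} (H : Hyp3 n) where

  pair∉edges : (x y : Fin n) → ¬ pair x y ∈ edges H
  pair∉edges x y xy∈H = 1+n≰n (subst (_≤ 2) (All.lookup (size3 H) xy∈H) (∣pair∣≤2 x y))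

  Unique⇒length≤deg : ∀ {y es} → Unique es → All (_∈ edges H) es → All (y ∈ₛ_) es →
    length es ≤ deg H y
  Unique⇒length≤deg {y} es! es⊆H y∈es =
    Unique-⊆⇒length≤ _≟S_ es! λ e∈es → ∈-filter⁺ (y ∈ₛ?_) (All.lookup es⊆H e∈es) (All.lookup y∈es e∈es)

  three-edges⇒3≤deg : ∀ {y e₁ e₂ e₃} → e₁ ≢ e₂ → e₁ ≢ e₃ → e₂ ≢ e₃ →
    All (_∈ edges H) (e₁ ∷ e₂ ∷ e₃ ∷ []) → All (y ∈ₛ_) (e₁ ∷ e₂ ∷ e₃ ∷ []) → 3 ≤ deg H y
  three-edges⇒3≤deg e₁≢e₂ e₁≢e₃ e₂≢e₃ =
    Unique⇒length≤deg ((e₁≢e₂ ∷ e₁≢e₃ ∷ []) ∷ (e₂≢e₃ ∷ []) ∷ [] ∷ [])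

  light-triple : ∀ {x y w} → deg H x ≤ 2 → deg H y ≤ 2 → deg H w ≤ 2 →
    ∀ {z} → z ∈ₛ triple x y w → deg H z ≤ 2
  light-triple x-light y-light w-light z∈xyw with ∈triple⁻ z∈xyw
  ... | inj₁ refl        = x-light
  ... | inj₂ (inj₁ refl) = y-light
  ... | inj₂ (inj₂ refl) = w-light

module _ {n : ℕ} {L : List (Subset n)} (B : BergeK4 L) where

  core∈hedge : ∀ {j k} → j ∈ᴷ k → core B j ∈ₛ hedge B k
  core∈hedge {k = k} (inj₁ refl) = covers₁ B k
  core∈hedge {k = k} (inj₂ refl) = covers₂ B k

  module _ {L′ : List (Subset n)} (k₀ : Fin 6) {e : Subset n} (e-fresh : ∀ k → hedge B k ≢ e)
           (ends∈e : ∀ {j} → j ∈ᴷ k₀ → core B j ∈ₛ e)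
           (e∈L′ : e ∈ L′) (others∈L′ : ∀ {k} → k ≢ k₀ → hedge B k ∈ L′) where

    private
      hedge′ : Fin 6 → Subset n
      hedge′ k with k ≟ k₀
      ... | yes _ = e
      ... | no  _ = hedge B k

      hedge′-inj : ∀ {k k′} → hedge′ k ≡ hedge′ k′ → k ≡ k′
      hedge′-inj {k} {k′} eq with k ≟ k₀ | k′ ≟ k₀
      ... | yes k≡k₀ | yes k′≡k₀ = trans k≡k₀ (sym k′≡k₀)
      ... | yes _    | no  _     = ⊥-elim (e-fresh k′ (sym eq))
      ... | no  _    | yes _     = ⊥-elim (e-fresh k eq)
      ... | no  _    | no  _     = hedge-inj B eq

      hedge′∈L′ : ∀ k → hedge′ k ∈ L′
      hedge′∈L′ k with k ≟ k₀
      ... | yes _    = e∈L′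
      ... | no  k≢k₀ = others∈L′ k≢k₀

      core∈hedge′ : ∀ {j k} → j ∈ᴷ k → core B j ∈ₛ hedge′ k
      core∈hedge′ {k = k} j∈k with k ≟ k₀
      ... | yes refl = ends∈e j∈k
      ... | no  _    = core∈hedge j∈k

    replace-hedge : BergeK4 L′
    replace-hedge = record
      { core      = core B
      ; core-inj  = core-inj B
      ; hedge     = hedge′
      ; hedge-inj = hedge′-inj
      ; hedge-∈   = hedge′∈L′
      ; covers₁   = λ k → core∈hedge′ {k = k} (inj₁ refl)
      ; covers₂   = λ k → core∈hedge′ {k = k} (inj₂ refl)
      }

module NewEdge {n : ℕ} (H : Hyp3 n) (H-free : ¬ BergeK4 (edges H)) (u v : Fin n)
               (B : BergeK4 (plusPair H u v)) {k₀ : Fin 6} (new : hedge B k₀ ≡ pair u v) where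

  old-hedge∈H : ∀ {k} → k ≢ k₀ → hedge B k ∈ edges H
  old-hedge∈H {k} k≢k₀ with hedge-∈ B k
  ... | here k↦uv = ⊥-elim (k≢k₀ (hedge-inj B (trans k↦uv (sym new))))
  ... | there k∈H = k∈H

  hedge-of-edge≢new : ∀ {k e} → e ∈ edges H → hedge B k ≡ e → k ≢ k₀
  hedge-of-edge≢new e∈H refl refl = pair∉edges H u v (subst (_∈ edges H) new e∈H)

  end-core≡u⊎v : ∀ {j} → j ∈ᴷ k₀ → core B j ≡ u ⊎ core B j ≡ v
  end-core≡u⊎v {j} j∈k₀ = ∈pair⁻ (subst (core B j ∈ₛ_) new (core∈hedge B j∈k₀))

  ends : ∃₂ λ a b → a ∈ᴷ k₀ × b ∈ᴷ k₀ × a ≢ b × core B a ≡ u × core B b ≡ v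
  ends with end-core≡u⊎v {proj₁ (k4edge k₀)} (inj₁ refl) | end-core≡u⊎v {proj₂ (k4edge k₀)} (inj₂ refl)
  ... | inj₁ a↦u | inj₂ b↦v = _ , _ , inj₁ refl , inj₂ refl , k4edge-ends-distinct k₀ , a↦u , b↦v
  ... | inj₂ b↦v | inj₁ a↦u = _ , _ , inj₂ refl , inj₁ refl , k4edge-ends-distinct k₀ ∘ sym , a↦u , b↦v
  ... | inj₁ p   | inj₁ q   = ⊥-elim (k4edge-ends-distinct k₀ (core-inj B (trans p (sym q))))
  ... | inj₂ p   | inj₂ q   = ⊥-elim (k4edge-ends-distinct k₀ (core-inj B (trans p (sym q))))

  off-core≢u : ∀ {j} → j ∉ᴷ k₀ → core B j ≢ u
  off-core≢u j∉k₀ j↦u with ends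
  ... | a , _ , a∈k₀ , _ , _ , a↦u , _ = j∉k₀ (subst (_∈ᴷ k₀) (core-inj B (trans a↦u (sym j↦u))) a∈k₀)

  off-core≢v : ∀ {j} → j ∉ᴷ k₀ → core B j ≢ v
  off-core≢v j∉k₀ j↦v with ends
  ... | _ , b , _ , b∈k₀ , _ , _ , b↦v = j∉k₀ (subst (_∈ᴷ k₀) (core-inj B (trans b↦v (sym j↦v))) b∈k₀)

  off-core-deg : ∀ {j} → j ∉ᴷ k₀ → 3 ≤ deg H (core B j)
  off-core-deg {j} j∉k₀ with three-edges-at j
  ... | k₁ , k₂ , k₃ , j∈k₁ , j∈k₂ , j∈k₃ , k₁≢k₂ , k₁≢k₃ , k₂≢k₃ =
    three-edges⇒3≤deg H (k₁≢k₂ ∘ hedge-inj B) (k₁≢k₃ ∘ hedge-inj B) (k₂≢k₃ ∘ hedge-inj B)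
      (old j∈k₁ ∷ old j∈k₂ ∷ old j∈k₃ ∷ [])
      (core∈hedge B j∈k₁ ∷ core∈hedge B j∈k₂ ∷ core∈hedge B j∈k₃ ∷ [])
    where
    old : ∀ {k} → j ∈ᴷ k → hedge B k ∈ edges H
    old j∈k = old-hedge∈H λ { refl → j∉k₀ j∈k }

  end-deg : ∀ {a x e} → a ∈ᴷ k₀ → core B a ≡ x → e ∈ edges H → x ∈ₛ e →
    (∀ {k} → a ∈ᴷ k → hedge B k ≢ e) → 3 ≤ deg H x
  end-deg {a} a∈k₀ refl e∈H a∈e e-fresh with two-other-edges-at-end k₀ a a∈k₀
  ... | k₁ , k₂ , a∈k₁ , a∈k₂ , k₁≢k₂ , k₁≢k₀ , k₂≢k₀ =
    three-edges⇒3≤deg H (e-fresh a∈k₁ ∘ sym) (e-fresh a∈k₂ ∘ sym) (k₁≢k₂ ∘ hedge-inj B)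
      (e∈H ∷ old-hedge∈H k₁≢k₀ ∷ old-hedge∈H k₂≢k₀ ∷ [])
      (a∈e ∷ core∈hedge B a∈k₁ ∷ core∈hedge B a∈k₂ ∷ [])

  end-deg-off-hedge : ∀ {a x k} → a ∈ᴷ k₀ → core B a ≡ x → k ≢ k₀ → a ∉ᴷ k → x ∈ₛ hedge B k →
    3 ≤ deg H x
  end-deg-off-hedge a∈k₀ a↦x k≢k₀ a∉k x∈hk =
    end-deg a∈k₀ a↦x (old-hedge∈H k≢k₀) x∈hk λ a∈k′ k′↦hk → a∉k (subst (_ ∈ᴷ_) (hedge-inj B k′↦hk) a∈k′)

  off-core-in-old-hedge : ∀ {k} → k ≢ k₀ → ∃ λ j → j ∉ᴷ k₀ × core B j ∈ₛ hedge B k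
  off-core-in-old-hedge {k} k≢k₀ with end-off-edge k₀ k k≢k₀
  ... | j , j∈k , j∉k₀ = j , j∉k₀ , core∈hedge B j∈k

  edge∋u,v⇒hedge : ∀ {e} → e ∈ edges H → u ∈ₛ e → v ∈ₛ e → ∃ λ k → hedge B k ≡ e
  edge∋u,v⇒hedge {e} e∈H u∈e v∈e = decidable-stable (any? λ k → hedge B k ≟S e) λ e-not-hedge →
    H-free (replace-hedge B k₀ (λ k k↦e → e-not-hedge (k , k↦e)) ends∈e e∈H old-hedge∈H)
    where
    ends∈e : ∀ {j} → j ∈ᴷ k₀ → core B j ∈ₛ e
    ends∈e j∈k₀ = [ (λ j↦u → subst (_∈ₛ e) (sym j↦u) u∈e) , (λ j↦v → subst (_∈ₛ e) (sym j↦v) v∈e) ]′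
                    (end-core≡u⊎v j∈k₀)

  third-vertex-is-off-core : ∀ {w} → IsEdge H (triple u v w) → ∃ λ j → j ∉ᴷ k₀ × core B j ≡ w
  third-vertex-is-off-core {w} uvw∈H with edge∋u,v⇒hedge uvw∈H (x∈triple u v w) (y∈triple u v w)
  ... | k , k↦uvw with off-core-in-old-hedge (hedge-of-edge≢new uvw∈H k↦uvw)
  ... | j , j∉k₀ , j∈hk with ∈triple⁻ (subst (core B j ∈ₛ_) k↦uvw j∈hk)
  ... | inj₁ j↦u        = ⊥-elim (off-core≢u j∉k₀ j↦u)
  ... | inj₂ (inj₁ j↦v) = ⊥-elim (off-core≢v j∉k₀ j↦v)
  ... | inj₂ (inj₂ j↦w) = j , j∉k₀ , j↦w

  third-vertex-deg : ∀ {w} → IsEdge H (triple u v w) → 3 ≤ deg H w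
  third-vertex-deg uvw∈H with third-vertex-is-off-core uvw∈H
  ... | j , j∉k₀ , refl = off-core-deg j∉k₀

  codeg≤2 : codeg H u v ≤ 2
  codeg≤2 with two-vertices-off-edge k₀
  ... | c , d , off⇒c⊎d = Unique-⊆⇒length≤ _≟_ (filter⁺ is-third? (allFin⁺ n)) nbrs⊆cd
    where
    is-third? : Decidable (λ w → IsEdge H (triple u v w))
    is-third? w = DecMem._∈?_ _≟S_ (triple u v w) (edges H)
    nbrs⊆cd : codegNbrs H u v ⊆ core B c ∷ core B d ∷ []
    nbrs⊆cd w∈nbrs with third-vertex-is-off-core (proj₂ (∈-filter⁻ is-third? {xs = allFin n} w∈nbrs))
    ... | j , j∉k₀ , refl with off⇒c⊎d j j∉k₀
    ... | inj₁ refl = here refl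
    ... | inj₂ refl = there (here refl)

  edge∋u,v⇒heavy-end : ∀ {e} → e ∈ edges H → u ∈ₛ e → v ∈ₛ e → 3 ≤ deg H u ⊎ 3 ≤ deg H v
  edge∋u,v⇒heavy-end e∈H u∈e v∈e with ends | edge∋u,v⇒hedge e∈H u∈e v∈e
  ... | a , b , a∈k₀ , b∈k₀ , a≢b , a↦u , b↦v | k , refl
    with k≢k₀ ← hedge-of-edge≢new e∈H refl
    with other-edge-misses-an-end a b k₀ k a≢b a∈k₀ b∈k₀ k≢k₀
  ... | inj₁ a∉k = inj₁ (end-deg-off-hedge a∈k₀ a↦u k≢k₀ a∉k u∈e)
  ... | inj₂ b∉k = inj₂ (end-deg-off-hedge b∈k₀ b↦v k≢k₀ b∉k v∈e)

  no-light-edge∋u : ∀ {e} → e ∈ edges H → u ∈ₛ e → ¬ (∀ {z} → z ∈ₛ e → deg H z ≤ 2)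
  no-light-edge∋u {e} e∈H u∈e light with any? (λ k → hedge B k ≟S e)
  ... | yes (k , refl) with off-core-in-old-hedge (hedge-of-edge≢new e∈H refl)
  ...   | j , j∉k₀ , j∈e = <⇒≱ (off-core-deg j∉k₀) (light j∈e)
  no-light-edge∋u {e} e∈H u∈e light | no e-not-hedge with ends
  ... | a , _ , a∈k₀ , _ , _ , a↦u , _ =
    <⇒≱ (end-deg a∈k₀ a↦u e∈H u∈e λ {k} _ k↦e → e-not-hedge (k , k↦e)) (light u∈e)

module BergeK4-free {n : ℕ} (H : Hyp3 n) (H-free : ¬ BergeK4 (edges H)) where

  module New = NewEdge H H-free

  good⇒codeg≤2 : ∀ {u v} → Good H u v → codeg H u v ≤ 2
  good⇒codeg≤2 {u} {v} (B , _ , new) = New.codeg≤2 u v B new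

  good⇒third-deg≥3 : ∀ {u v w} → Good H u v → IsEdge H (triple u v w) → 3 ≤ deg H w
  good⇒third-deg≥3 {u} {v} (B , _ , new) = New.third-vertex-deg u v B new

  light-third⇒bad : ∀ {u v w} → IsEdge H (triple u v w) → deg H w ≤ 2 → Bad H u v
  light-third⇒bad uvw∈H w-light good = <⇒≱ (good⇒third-deg≥3 good uvw∈H) w-light

  light-ends⇒bad : ∀ {u v e} → IsEdge H e → u ∈ₛ e → v ∈ₛ e → deg H u ≤ 2 → deg H v ≤ 2 → Bad H u v
  light-ends⇒bad {u} {v} e∈H u∈e v∈e u-light v-light (B , _ , new) =
    [ (λ u-heavy → <⇒≱ u-heavy u-light) , (λ v-heavy → <⇒≱ v-heavy v-light) ]′
      (New.edge∋u,v⇒heavy-end u v B new e∈H u∈e v∈e)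

  light-edge⇒bad : ∀ {u e} → IsEdge H e → u ∈ₛ e → (∀ {z} → z ∈ₛ e → deg H z ≤ 2) → ∀ v → Bad H u v
  light-edge⇒bad {u} e∈H u∈e light v (B , _ , new) = New.no-light-edge∋u u v B new e∈H u∈e light

fact3p1 : (n : ℕ) → 5 ≤ n → (H : Hyp3 n) → Saturated H →
    -- (i)
    (∀ (u v : Fin n) → u ≢ v → Good H u v →
      (∀ (B : BergeK4 (plusPair H u v)) → UsesNew H u v B →
        ∀ (e : Subset n) → IsEdge H e → u ∈ₛ e → v ∈ₛ e →
          ∃ λ k → hedge B k ≡ e)
      × codeg H u v ≤ 2
      × (∀ (w : Fin n) → IsEdge H (triple u v w) → 3 ≤ deg H w))
    ×
    -- (ii)
    (∀ (v₁ v₂ v₃ : Fin n) → IsEdge H (triple v₁ v₂ v₃) →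
      deg H v₁ ≤ deg H v₂ → deg H v₂ ≤ deg H v₃ →
      (deg H v₁ ≤ 2 → Bad H v₂ v₃)
      × (deg H v₂ ≤ 2 → Bad H v₁ v₂ × Bad H v₁ v₃ × Bad H v₂ v₃)
      × (deg H v₃ ≤ 2 → ∀ (u : Fin n) → u ≢ v₁ → u ≢ v₂ → u ≢ v₃ →
          Bad H v₁ u × Bad H v₂ u × Bad H v₃ u))
fact3p1 n _ H (H-free , _) =
  (λ u v _ good →
      (λ B (_ , new) _ → New.edge∋u,v⇒hedge u v B new)
    , good⇒codeg≤2 good
    , λ _ → good⇒third-deg≥3 good)
  , λ v₁ v₂ v₃ t∈H d₁≤d₂ d₂≤d₃ →
    let v₂₃v₁∈H = subst (IsEdge H) (triple-rotate v₁ v₂ v₃) t∈H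
        v₁₃v₂∈H = subst (IsEdge H) (triple-swap v₁ v₂ v₃) t∈H
    in  (λ d₁≤2 → light-third⇒bad v₂₃v₁∈H d₁≤2)
      , (λ d₂≤2 → let d₁≤2 = ≤-trans d₁≤d₂ d₂≤2 in
            light-ends⇒bad t∈H (x∈triple v₁ v₂ v₃) (y∈triple v₁ v₂ v₃) d₁≤2 d₂≤2
          , light-third⇒bad v₁₃v₂∈H d₂≤2
          , light-third⇒bad v₂₃v₁∈H d₁≤2)
      , λ d₃≤2 u _ _ _ →
          let d₂≤2 = ≤-trans d₂≤d₃ d₃≤2
              light = light-triple H (≤-trans d₁≤d₂ d₂≤2) d₂≤2 d₃≤2
          in  light-edge⇒bad t∈H (x∈triple v₁ v₂ v₃) light u
            , light-edge⇒bad t∈H (y∈triple v₁ v₂ v₃) light u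
            , light-edge⇒bad t∈H (w∈triple v₁ v₂ v₃) light u
  where
  open BergeK4-free H H-free
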